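{- Let $m$, $n$, $\mu$ be positive integers such that $2m+n=(4^\mu-1)/3$ and $$m\le\begin{cases}(4^\mu-2.5\cdot 2^\mu+1)/9 & \text{if } \mu \text{ is odd},\\ (4^\mu-2\cdot2^\mu+1)/9 & \text{if } \mu \text{ is even}.\end{cases}$$ Then there is a $1$-perfect code in the Doob graph $D(m,n)$.
   Context: The Shrikhande graph is the Cayley graph of the additive group of $\mathbb{E}/4\mathbb{E}$ (where $\mathbb{E}=\{a+b\omega:a,b\in\mathbb{Z}\}$, $\omega=e^{2\pi i/3}$) with generating set $\{\pm1,\pm\omega,\pm\omega^2\}$; $K$ is the complete graph on $4$ vertices. The Doob graph $D(m,n)$ ($m>0$) is the Cartesian product of $m$ copies of the Shrikhande graph and $n$ copies of $K$. A $1$-perfect code is a set of vertices whose radius-$1$ balls partition the vertex set. -}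

module Defs where

open import Data.Nat using (ℕ)
open import Data.Fin using (Fin; zero; suc)
open import Data.Product using (_×_; _,_; ∃-syntax)
open import Data.Sum using (_⊎_)
open import Data.Vec using (Vec; []; _∷_)
open import Relation.Binary.PropositionalEquality using (_≡_; _≢_)

Z4 : Set
Z4 = Fin 4

inc4 : Z4 → Z4
inc4 zero = suc zero
inc4 (suc zero) = suc (suc zero)
inc4 (suc (suc zero)) = suc (suc (suc zero))
inc4 (suc (suc (suc zero))) = zero

neg4 : Z4 → Z4
neg4 zero = zero
neg4 (suc zero) = suc (suc (suc zero))
neg4 (suc (suc zero)) = suc (suc zero)
neg4 (suc (suc (suc zero))) = suc zero

_⊕₄_ : Z4 → Z4 → Z4
zero ⊕₄ y = y
suc zero ⊕₄ y = inc4 y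
suc (suc zero) ⊕₄ y = inc4 (inc4 y)
suc (suc (suc zero)) ⊕₄ y = inc4 (inc4 (inc4 y))

_⊖₄_ : Z4 → Z4 → Z4
x ⊖₄ y = x ⊕₄ neg4 y

-- Shrikhande graph: Cayley graph of E/4E, E = Z[ω], with generators
-- ±1, ±ω, ±ω².  The element a + bω is represented by (a , b) ∈ Z4 × Z4.
-- Since ω² = -1 - ω, the generators are
--   ±1 = ±(1,0),  ±ω = ±(0,1),  ±ω² = ∓(1,1).

Shr : Set
Shr = Z4 × Z4

_-S_ : Shr → Shr → Shr
(a , b) -S (c , d) = (a ⊖₄ c) , (b ⊖₄ d)

one3 : Z4
one3 = suc (suc (suc zero))

data ShrGen : Shr → Set where
  g+1  : ShrGen (suc zero , zero)
  g-1  : ShrGen (one3 , zero)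
  g+ω  : ShrGen (zero , suc zero)
  g-ω  : ShrGen (zero , one3)
  g+ω² : ShrGen (one3 , one3)           -- ω² = -1 - ω
  g-ω² : ShrGen (suc zero , suc zero)   -- -ω² = 1 + ω

ShrAdj : Shr → Shr → Set
ShrAdj x y = ShrGen (x -S y)

KAdj : Fin 4 → Fin 4 → Set
KAdj x y = x ≢ y

data VecAdj {A : Set} (R : A → A → Set) : {k : ℕ} → Vec A k → Vec A k → Set where
  here  : ∀ {k x y} {xs : Vec A k} → R x y → VecAdj R (x ∷ xs) (y ∷ xs)
  there : ∀ {k x} {xs ys : Vec A k} → VecAdj R xs ys → VecAdj R (x ∷ xs) (x ∷ ys)

DoobV : ℕ → ℕ → Set
DoobV m n = Vec Shr m × Vec (Fin 4) n

DoobAdj : ∀ {m n} → DoobV m n → DoobV m n → Set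
DoobAdj (xs , us) (ys , vs) =
  (VecAdj ShrAdj xs ys × us ≡ vs) ⊎ (xs ≡ ys × VecAdj KAdj us vs)

InBall1 : ∀ {m n} → DoobV m n → DoobV m n → Set
InBall1 c x = c ≡ x ⊎ DoobAdj c x

IsPerfectCode1 : ∀ {m n} → (DoobV m n → Set) → Set
IsPerfectCode1 {m} {n} C =
  ∀ (x : DoobV m n) →
    (∃[ c ] (C c × InBall1 c x)) ×
    (∀ c c' → C c → C c' → InBall1 c x → InBall1 c' x → c ≡ c')

module Submission where

-- Perfect codes in the Doob graph D(m, n), built from parity checks over GF(4).
--
-- Pair every Shrikhande coordinate with a K coordinate into a block Sh × K.
-- A fixed labelling λ : Sh × K → GF(4)² has the property, checked
-- exhaustively, that the nine neighbours of any vertex p carry exactly the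
-- labels λ(p) + (a, x) with a, x ≠ 0.  Give every block i an additive map
-- Eᵢ : GF(4)² → GF(4)^μ and every remaining (lone) K coordinate j an additive
-- map eⱼ : GF(4) → GF(4)^μ; the syndrome of a vertex is Σ Eᵢ(λ(block i)) +
-- Σ eⱼ(coordinate j).  Moving to a neighbour adds the column Eᵢ(a, x) or eⱼ(a)
-- of the direction moved in, so if every nonzero vector of GF(4)^μ is the
-- column of exactly one direction (a perfect check system), the vertices of
-- syndrome zero form a 1-perfect code (perfectCode).
--
-- Perfect check systems are built by adding one check row at a time
-- (Extension), starting from the empty system; this reaches m blocks and r
-- lone coordinates at level μ whenever 3m + r = (4^μ − 1)/3 and
-- m ≤ maxBlocks μ (reachable).  The theorem follows because its numerical
-- hypotheses give 2m + n = (4^μ − 1)/3, m ≤ maxBlocks μ and m ≤ n, so that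
-- D(m, n) = D(m, m + r) with r = n − m.

open import Defs
open import Data.Nat using (ℕ; suc; zero; _+_; _*_; _^_; _≤_; _∸_; z≤n; s≤s; NonZero; _<?_)
open import Data.Nat.Properties using (≤-refl; ≤-trans; ≤-pred; ≮⇒≥; m≤m+n; m≤n⇒∃[o]m+o≡n; m+[n∸m]≡n; +-assoc; +-comm; +-monoʳ-≤; *-monoʳ-≤; +-cancelˡ-≡; +-cancelʳ-≡; *-cancelˡ-≡; +-cancelˡ-≤; +-cancelʳ-≤; *-cancelˡ-≤; module ≤-Reasoning)
open import Data.Nat.Tactic.RingSolver using (solve-∀)
open import Data.Fin using (Fin; zero; suc)
open import Data.Fin.Patterns using (0F; 1F; 2F; 3F; 4F; 5F)
open import Data.Fin.Properties using (all?; any?; 0≢1+n; +↔⊎; *↔×; 1↔⊤) renaming (_≟_ to _≟F_)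
open import Data.Product using (_×_; _,_; ∃-syntax; proj₁; proj₂)
open import Data.Product.Properties using () renaming (≡-dec to ×-≡-dec)
open import Data.Sum using (_⊎_; inj₁; inj₂)
open import Data.Sum.Properties using () renaming (≡-dec to ⊎-≡-dec)
open import Data.Sum.Function.Propositional using (_⊎-↔_)
open import Data.Maybe using (Maybe; just; nothing; maybe)
open import Data.Maybe.Properties using (just-injective)
open import Data.Unit using (⊤; tt)
open import Data.Vec using (Vec; []; _∷_; head; tail; lookup; zipWith; replicate; updateAt)
open import Data.Vec.Properties using (zipWith-assoc; zipWith-identityˡ; ∷-injective) renaming (≡-dec to Vec-≡-dec)
open import Data.Empty using (⊥-elim)
open import Function.Bundles using (_↔_; Inverse)
open import Function.Properties.Inverse using (↔-refl; ↔-sym; ↔-trans)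
open import Relation.Nullary using (Dec; yes; no)
open import Relation.Nullary.Decidable using (from-yes; map′; ¬?; _×-dec_; _⊎-dec_; _→-dec_)
open import Relation.Unary using (Decidable)
open import Relation.Binary.PropositionalEquality using (_≡_; _≢_; refl; cong; cong₂; sym; trans; subst; subst₂; module ≡-Reasoning)

-- The field GF(4) = {0, 1, ω, ω² = 1 + ω}, encoded as 0F, 1F, 2F, 3F so that
-- addition is bitwise exclusive or.  Nonzero elements are written suc a with
-- a : Fin 3.

F4 : Set
F4 = Fin 4

infixl 6 _⊕_
infixl 7 _·_

_⊕_ : F4 → F4 → F4
a ⊕ b = lookup (row a) b
  where
  row : F4 → Vec F4 4
  row 0F = 0F ∷ 1F ∷ 2F ∷ 3F ∷ []
  row 1F = 1F ∷ 0F ∷ 3F ∷ 2F ∷ []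
  row 2F = 2F ∷ 3F ∷ 0F ∷ 1F ∷ []
  row 3F = 3F ∷ 2F ∷ 1F ∷ 0F ∷ []

_·_ : F4 → F4 → F4
a · b = lookup (row a) b
  where
  row : F4 → Vec F4 4
  row 0F = 0F ∷ 0F ∷ 0F ∷ 0F ∷ []
  row 1F = 0F ∷ 1F ∷ 2F ∷ 3F ∷ []
  row 2F = 0F ∷ 2F ∷ 3F ∷ 1F ∷ []
  row 3F = 0F ∷ 3F ∷ 1F ∷ 2F ∷ []

_÷_ : F4 → Fin 3 → F4
f ÷ a = f · inverse a
  where
  inverse : Fin 3 → F4
  inverse 0F = 1F
  inverse 1F = 3F
  inverse 2F = 2F

⊕-assoc : ∀ a b c → (a ⊕ b) ⊕ c ≡ a ⊕ (b ⊕ c)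
⊕-assoc = from-yes (all? λ a → all? λ b → all? λ c → (a ⊕ b) ⊕ c ≟F a ⊕ (b ⊕ c))

⊕-swap : ∀ a b c → a ⊕ (b ⊕ c) ≡ b ⊕ (a ⊕ c)
⊕-swap = from-yes (all? λ a → all? λ b → all? λ c → a ⊕ (b ⊕ c) ≟F b ⊕ (a ⊕ c))

⊕-identityˡ : ∀ a → 0F ⊕ a ≡ a
⊕-identityˡ = from-yes (all? λ a → 0F ⊕ a ≟F a)

⊕-self : ∀ a → a ⊕ a ≡ 0F
⊕-self = from-yes (all? λ a → a ⊕ a ≟F 0F)

⊕≡0⇒≡ : ∀ a b → a ⊕ b ≡ 0F → a ≡ b
⊕≡0⇒≡ = from-yes (all? λ a → all? λ b → a ⊕ b ≟F 0F →-dec a ≟F b)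

·-distribˡ : ∀ c a b → c · (a ⊕ b) ≡ c · a ⊕ c · b
·-distribˡ = from-yes (all? λ c → all? λ a → all? λ b → c · (a ⊕ b) ≟F c · a ⊕ c · b)

÷-· : ∀ f a → (f ÷ a) · suc a ≡ f
÷-· = from-yes (all? λ f → all? λ a → (f ÷ a) · suc a ≟F f)

·-÷ : ∀ c a → (c · suc a) ÷ a ≡ c
·-÷ = from-yes (all? λ c → all? λ a → (c · suc a) ÷ a ≟F c)

⊕-nonzero : ∀ u d → u ⊕ suc d ≢ u
⊕-nonzero = from-yes (all? λ u → all? λ d → ¬? (u ⊕ suc d ≟F u))

equal-or-shifted : ∀ u u' → u' ≡ u ⊎ ∃[ d ] u' ≡ u ⊕ suc d
equal-or-shifted = from-yes (all? λ u → all? λ u' → u' ≟F u ⊎-dec any? λ d → u' ≟F u ⊕ suc d)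

Syn : ℕ → Set
Syn k = Vec F4 k

infixl 6 _⊕ᵛ_

_⊕ᵛ_ : ∀ {k} → Syn k → Syn k → Syn k
_⊕ᵛ_ = zipWith _⊕_

0ᵛ : ∀ {k} → Syn k
0ᵛ {k} = replicate k 0F

_≟ᵛ_ : ∀ {k} (s t : Syn k) → Dec (s ≡ t)
_≟ᵛ_ = Vec-≡-dec _≟F_

⊕ᵛ-identityˡ : ∀ {k} (s : Syn k) → 0ᵛ ⊕ᵛ s ≡ s
⊕ᵛ-identityˡ = zipWith-identityˡ ⊕-identityˡ

⊕ᵛ-self : ∀ {k} (s : Syn k) → s ⊕ᵛ s ≡ 0ᵛ
⊕ᵛ-self [] = refl
⊕ᵛ-self (a ∷ s) = cong₂ _∷_ (⊕-self a) (⊕ᵛ-self s)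

⊕ᵛ-swap : ∀ {k} (s t v : Syn k) → s ⊕ᵛ (t ⊕ᵛ v) ≡ t ⊕ᵛ (s ⊕ᵛ v)
⊕ᵛ-swap [] [] [] = refl
⊕ᵛ-swap (a ∷ s) (b ∷ t) (c ∷ v) = cong₂ _∷_ (⊕-swap a b c) (⊕ᵛ-swap s t v)

⊕ᵛ-rotate : ∀ {k} (s t v : Syn k) → (s ⊕ᵛ t) ⊕ᵛ v ≡ t ⊕ᵛ (s ⊕ᵛ v)
⊕ᵛ-rotate s t v = trans (zipWith-assoc ⊕-assoc s t v) (⊕ᵛ-swap s t v)

-- in characteristic 2, s + t = 0 means s = t
⊕ᵛ≡0⇒≡ : ∀ {k} (s t : Syn k) → s ⊕ᵛ t ≡ 0ᵛ → s ≡ t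
⊕ᵛ≡0⇒≡ [] [] _ = refl
⊕ᵛ≡0⇒≡ (a ∷ s) (b ∷ t) eq =
  cong₂ _∷_ (⊕≡0⇒≡ a b (proj₁ (∷-injective eq))) (⊕ᵛ≡0⇒≡ s t (proj₂ (∷-injective eq)))

_+S_ : Shr → Shr → Shr
s +S d = proj₁ s ⊕₄ proj₁ d , proj₂ s ⊕₄ proj₂ d

generator : Fin 6 → Shr
generator 0F = 1F , 0F
generator 1F = 3F , 0F
generator 2F = 0F , 1F
generator 3F = 0F , 3F
generator 4F = 3F , 3F
generator 5F = 1F , 1F

generator-isGen : ∀ g → ShrGen (generator g)
generator-isGen 0F = g+1
generator-isGen 1F = g-1
generator-isGen 2F = g+ω
generator-isGen 3F = g-ω
generator-isGen 4F = g+ω²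
generator-isGen 5F = g-ω²

isGen⇒generator : ∀ {d} → ShrGen d → ∃[ g ] d ≡ generator g
isGen⇒generator g+1 = 0F , refl
isGen⇒generator g-1 = 1F , refl
isGen⇒generator g+ω = 2F , refl
isGen⇒generator g-ω = 3F , refl
isGen⇒generator g+ω² = 4F , refl
isGen⇒generator g-ω² = 5F , refl

+S-S : ∀ s d → (s +S d) -S s ≡ d
+S-S (a , b) (c , d) = cong₂ _,_ (lemma a c) (lemma b d)
  where
  lemma : ∀ a c → (a ⊕₄ c) ⊖₄ a ≡ c
  lemma = from-yes (all? λ a → all? λ c → (a ⊕₄ c) ⊖₄ a ≟F c)

S+-S : ∀ s' s → s' ≡ s +S (s' -S s)
S+-S (a' , b') (a , b) = cong₂ _,_ (lemma a' a) (lemma b' b)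
  where
  lemma : ∀ a' a → a' ≡ a ⊕₄ (a' ⊖₄ a)
  lemma = from-yes (all? λ a' → all? λ a → a' ≟F a ⊕₄ (a' ⊖₄ a))

Block : Set
Block = Shr × F4

BlockAdj : Block → Block → Set
BlockAdj (s' , u') (s , u) = (ShrAdj s' s × u' ≡ u) ⊎ (s' ≡ s × KAdj u' u)

Move : Set
Move = Fin 6 ⊎ Fin 3

move : Move → Block → Block
move (inj₁ g) (s , u) = s +S generator g , u
move (inj₂ d) (s , u) = s , u ⊕ suc d

move-adjacent : ∀ k p → BlockAdj (move k p) p
move-adjacent (inj₁ g) (s , u) = inj₁ (subst ShrGen (sym (+S-S s (generator g))) (generator-isGen g) , refl)
move-adjacent (inj₂ d) (s , u) = inj₂ (refl , ⊕-nonzero u d)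

adjacent-move : ∀ q p → BlockAdj q p → ∃[ k ] q ≡ move k p
adjacent-move (s' , u) (s , u) (inj₁ (adj , refl)) with isGen⇒generator adj
... | g , eq = inj₁ g , cong (_, u) (trans (S+-S s' s) (cong (s +S_) eq))
adjacent-move (s , u') (s , u) (inj₂ (refl , u'≢u)) with equal-or-shifted u u'
... | inj₁ u'≡u = ⊥-elim (u'≢u u'≡u)
... | inj₂ (d , eq) = inj₂ d , cong (s ,_) eq

-- Its defining
-- property (checked exhaustively below) is that for every vertex p the nine
-- neighbours of p are labelled by exactly the nine pairs λ(p) + (a, x) with
-- a, x ≠ 0.

F4² : Set
F4² = F4 × F4

infixl 6 _⊕²_

_⊕²_ : F4² → F4² → F4²
(a , x) ⊕² (b , y) = a ⊕ b , x ⊕ y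

infix 4 _≟²_

_≟²_ : (p q : F4²) → Dec (p ≡ q)
_≟²_ = ×-≡-dec _≟F_ _≟F_

nz² : Fin 3 → Fin 3 → F4²
nz² a x = suc a , suc x

labelRow : Shr → Vec F4² 4
labelRow (0F , 0F) = (0F , 0F) ∷ (1F , 3F) ∷ (2F , 2F) ∷ (3F , 1F) ∷ []
labelRow (0F , 1F) = (2F , 1F) ∷ (3F , 2F) ∷ (1F , 0F) ∷ (0F , 3F) ∷ []
labelRow (0F , 2F) = (1F , 3F) ∷ (0F , 0F) ∷ (3F , 1F) ∷ (2F , 2F) ∷ []
labelRow (0F , 3F) = (3F , 2F) ∷ (2F , 1F) ∷ (0F , 3F) ∷ (1F , 0F) ∷ []
labelRow (1F , 0F) = (1F , 1F) ∷ (0F , 2F) ∷ (3F , 0F) ∷ (2F , 3F) ∷ []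
labelRow (1F , 1F) = (3F , 3F) ∷ (2F , 0F) ∷ (0F , 1F) ∷ (1F , 2F) ∷ []
labelRow (1F , 2F) = (0F , 2F) ∷ (1F , 1F) ∷ (2F , 3F) ∷ (3F , 0F) ∷ []
labelRow (1F , 3F) = (2F , 0F) ∷ (3F , 3F) ∷ (1F , 2F) ∷ (0F , 1F) ∷ []
labelRow (2F , 0F) = (0F , 3F) ∷ (1F , 0F) ∷ (2F , 1F) ∷ (3F , 2F) ∷ []
labelRow (2F , 1F) = (2F , 2F) ∷ (3F , 1F) ∷ (1F , 3F) ∷ (0F , 0F) ∷ []
labelRow (2F , 2F) = (1F , 0F) ∷ (0F , 3F) ∷ (3F , 2F) ∷ (2F , 1F) ∷ []
labelRow (2F , 3F) = (3F , 1F) ∷ (2F , 2F) ∷ (0F , 0F) ∷ (1F , 3F) ∷ []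
labelRow (3F , 0F) = (1F , 2F) ∷ (0F , 1F) ∷ (3F , 3F) ∷ (2F , 0F) ∷ []
labelRow (3F , 1F) = (3F , 0F) ∷ (2F , 3F) ∷ (0F , 2F) ∷ (1F , 1F) ∷ []
labelRow (3F , 2F) = (0F , 1F) ∷ (1F , 2F) ∷ (2F , 0F) ∷ (3F , 3F) ∷ []
labelRow (3F , 3F) = (2F , 3F) ∷ (3F , 0F) ∷ (1F , 1F) ∷ (0F , 2F) ∷ []

label : Block → F4²
label (s , u) = lookup (labelRow s) u

allBlocks? : {P : Block → Set} → Decidable P → Dec (∀ p → P p)
allBlocks? P? = map′ (λ h p → h (proj₁ (proj₁ p)) (proj₂ (proj₁ p)) (proj₂ p)) (λ h a b c → h ((a , b) , c))
  (all? λ a → all? λ b → all? λ c → P? ((a , b) , c))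

allMoves? : {P : Move → Set} → Decidable P → Dec (∀ k → P k)
allMoves? P? = map′ (λ h → λ { (inj₁ g) → proj₁ h g ; (inj₂ d) → proj₂ h d }) (λ h → (λ g → h (inj₁ g)) , (λ d → h (inj₂ d)))
  (all? (λ g → P? (inj₁ g)) ×-dec all? (λ d → P? (inj₂ d)))

anyMove? : {P : Move → Set} → Decidable P → Dec (∃[ k ] P k)
anyMove? P? = map′ (λ { (inj₁ (g , h)) → inj₁ g , h ; (inj₂ (d , h)) → inj₂ d , h })
  (λ { (inj₁ g , h) → inj₁ (g , h) ; (inj₂ d , h) → inj₂ (d , h) })
  (any? (λ g → P? (inj₁ g)) ⊎-dec any? (λ d → P? (inj₂ d)))

-- They are abstract so that later type
-- checking never unfolds the evaluation behind them.

abstract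
  move-for-label : ∀ p a x → ∃[ k ] label (move k p) ≡ label p ⊕² nz² a x
  move-for-label = from-yes (allBlocks? λ p → all? λ a → all? λ x → anyMove? λ k → label (move k p) ≟² label p ⊕² nz² a x)

  move-label-nonzero : ∀ p k → ∃[ a ] ∃[ x ] label (move k p) ≡ label p ⊕² nz² a x
  move-label-nonzero = from-yes (allBlocks? λ p → allMoves? λ k → any? λ a → any? λ x → label (move k p) ≟² label p ⊕² nz² a x)

  move-label-injective : ∀ p k k' → label (move k p) ≡ label (move k' p) → k ≡ k'
  move-label-injective = from-yes (allBlocks? λ p → allMoves? λ k → allMoves? λ k' →
    label (move k p) ≟² label (move k' p) →-dec ⊎-≡-dec _≟F_ _≟F_ k k')

step : Block → Fin 3 → Fin 3 → Block
step p a x = move (proj₁ (move-for-label p a x)) p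

step-adjacent : ∀ p a x → BlockAdj (step p a x) p
step-adjacent p a x = move-adjacent (proj₁ (move-for-label p a x)) p

step-label : ∀ p a x → label (step p a x) ≡ label p ⊕² nz² a x
step-label p a x = proj₂ (move-for-label p a x)

-- every neighbour is a step: its move realises some nonzero difference, and
-- the move chosen by step for that difference must be the same move
adjacent-step : ∀ {q p} → BlockAdj q p → ∃[ a ] ∃[ x ] q ≡ step p a x
adjacent-step {q} {p} adj with adjacent-move q p adj
... | k , refl with move-label-nonzero p k
... | a , x , eq = a , x , cong (λ k → move k p)
        (move-label-injective p k (proj₁ (move-for-label p a x)) (trans eq (sym (step-label p a x))))

-- Parity-check systems.  A direction is either a pair of nonzero values in
-- a block, or a nonzero value in a lone K coordinate; its column is the
-- syndrome contributed by that error.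

data Dir (I J : Set) : Set where
  block : I → Fin 3 → Fin 3 → Dir I J
  coord : J → Fin 3 → Dir I J

record Columns (k : ℕ) (I J : Set) : Set where
  field
    blockCol : I → F4² → Syn k
    coordCol : J → F4 → Syn k
    blockCol-additive : ∀ i p q → blockCol i (p ⊕² q) ≡ blockCol i p ⊕ᵛ blockCol i q
    coordCol-additive : ∀ j a b → coordCol j (a ⊕ b) ≡ coordCol j a ⊕ᵛ coordCol j b

  column : Dir I J → Syn k
  column (block i a x) = blockCol i (nz² a x)
  column (coord j a) = coordCol j (suc a)

record PerfectCheck (k : ℕ) (I J : Set) : Set where
  field
    columns : Columns k I J
  open Columns columns public
  field
    column-nonzero : ∀ D → column D ≢ 0ᵛ
    column-cover : ∀ t → t ≢ 0ᵛ → ∃[ D ] column D ≡ t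
    column-injective : ∀ D D' → column D ≡ column D' → D ≡ D'

coordShift : ∀ {r} → Fin r → Fin 3 → Vec F4 r → Vec F4 r
coordShift j d us = updateAt us j (_⊕ suc d)

coordSyndrome : ∀ {k r} → (Fin r → F4 → Syn k) → Vec F4 r → Syn k
coordSyndrome e [] = 0ᵛ
coordSyndrome e (u ∷ us) = e 0F u ⊕ᵛ coordSyndrome (λ j → e (suc j)) us

coordShift-adjacent : ∀ {r} j d (us : Vec F4 r) → VecAdj KAdj (coordShift j d us) us
coordShift-adjacent 0F d (u ∷ us) = here (⊕-nonzero u d)
coordShift-adjacent (suc j) d (u ∷ us) = there (coordShift-adjacent j d us)

coord-neighbour : ∀ {r} {us' us : Vec F4 r} → VecAdj KAdj us' us → ∃[ j ] ∃[ d ] us' ≡ coordShift j d us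
coord-neighbour (here {x = u'} {y = u} u'≢u) with equal-or-shifted u u'
... | inj₁ u'≡u = ⊥-elim (u'≢u u'≡u)
... | inj₂ (d , eq) = 0F , d , cong (_∷ _) eq
coord-neighbour (there adj) with coord-neighbour adj
... | j , d , eq = suc j , d , cong (_ ∷_) eq

coordShift-syndrome : ∀ {k r} (e : Fin r → F4 → Syn k) → (∀ j a b → e j (a ⊕ b) ≡ e j a ⊕ᵛ e j b) →
  ∀ j d us → coordSyndrome e (coordShift j d us) ≡ e j (suc d) ⊕ᵛ coordSyndrome e us
coordShift-syndrome e additive 0F d (u ∷ us) =
  trans (cong (_⊕ᵛ _) (additive 0F u (suc d))) (⊕ᵛ-rotate _ _ _)
coordShift-syndrome e additive (suc j) d (u ∷ us) =
  trans (cong (e 0F u ⊕ᵛ_) (coordShift-syndrome (λ j → e (suc j)) (λ j → additive (suc j)) j d us))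
        (⊕ᵛ-swap _ _ _)

-- The Doob graph D(m, m + r): the first m K coordinates are paired with the
-- m Shrikhande coordinates into blocks, the remaining r are lone.

infixr 5 _◂_

_◂_ : ∀ {m n} → Block → DoobV m n → DoobV (suc m) (suc n)
(s , u) ◂ (xs , us) = (s ∷ xs) , (u ∷ us)

◂-adjacentʰ : ∀ {m n} {p' p} (v : DoobV m n) → BlockAdj p' p → DoobAdj (p' ◂ v) (p ◂ v)
◂-adjacentʰ {p' = s' , u'} {s , u} v (inj₁ (adj , refl)) = inj₁ (here adj , refl)
◂-adjacentʰ {p' = s' , u'} {s , u} v (inj₂ (refl , adj)) = inj₂ (refl , here adj)

◂-adjacentᵗ : ∀ {m n} p {v' v : DoobV m n} → DoobAdj v' v → DoobAdj (p ◂ v') (p ◂ v)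
◂-adjacentᵗ (s , u) (inj₁ (adj , refl)) = inj₁ (there adj , refl)
◂-adjacentᵗ (s , u) (inj₂ (refl , adj)) = inj₂ (refl , there adj)

◂-adjacent-inv : ∀ {m n} {p' p} {v' v : DoobV m n} → DoobAdj (p' ◂ v') (p ◂ v) →
  (BlockAdj p' p × v' ≡ v) ⊎ (p' ≡ p × DoobAdj v' v)
◂-adjacent-inv {p' = s' , u'} {s , u} (inj₁ (here adj , refl)) = inj₁ (inj₁ (adj , refl) , refl)
◂-adjacent-inv {p' = s' , u'} {s , u} (inj₁ (there adj , refl)) = inj₂ (refl , inj₁ (adj , refl))
◂-adjacent-inv {p' = s' , u'} {s , u} (inj₂ (refl , here adj)) = inj₁ (inj₂ (refl , adj) , refl)
◂-adjacent-inv {p' = s' , u'} {s , u} (inj₂ (refl , there adj)) = inj₂ (refl , inj₂ (refl , adj))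

shift : ∀ {m r} → Dir (Fin m) (Fin r) → DoobV m (m + r) → DoobV m (m + r)
shift {zero} (block () _ _) _
shift {zero} (coord j d) ([] , us) = [] , coordShift j d us
shift {suc m} (block 0F a x) ((s ∷ xs) , (u ∷ us)) = step (s , u) a x ◂ (xs , us)
shift {suc m} (block (suc i) a x) ((s ∷ xs) , (u ∷ us)) = (s , u) ◂ shift (block i a x) (xs , us)
shift {suc m} (coord j d) ((s ∷ xs) , (u ∷ us)) = (s , u) ◂ shift (coord j d) (xs , us)

shift-adjacent : ∀ {m r} (D : Dir (Fin m) (Fin r)) v → DoobAdj (shift D v) v
shift-adjacent {zero} (coord j d) ([] , us) = inj₂ (refl , coordShift-adjacent j d us)
shift-adjacent {suc m} (block 0F a x) ((s ∷ xs) , (u ∷ us)) = ◂-adjacentʰ (xs , us) (step-adjacent (s , u) a x)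
shift-adjacent {suc m} (block (suc i) a x) ((s ∷ xs) , (u ∷ us)) = ◂-adjacentᵗ (s , u) (shift-adjacent (block i a x) (xs , us))
shift-adjacent {suc m} (coord j d) ((s ∷ xs) , (u ∷ us)) = ◂-adjacentᵗ (s , u) (shift-adjacent (coord j d) (xs , us))

liftDir : ∀ {m r} → Dir (Fin m) (Fin r) → Dir (Fin (suc m)) (Fin r)
liftDir (block i a x) = block (suc i) a x
liftDir (coord j d) = coord j d

shift-liftDir : ∀ {m r} (D : Dir (Fin m) (Fin r)) p v → shift (liftDir D) (p ◂ v) ≡ p ◂ shift D v
shift-liftDir (block i a x) (s , u) (xs , us) = refl
shift-liftDir (coord j d) (s , u) (xs , us) = refl

neighbour-shift : ∀ {m r} {w v : DoobV m (m + r)} → DoobAdj w v → ∃[ D ] w ≡ shift D v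
neighbour-shift {zero} {w = [] , us'} {[] , us} (inj₂ (_ , adj)) with coord-neighbour adj
... | j , d , refl = coord j d , refl
neighbour-shift {suc m} {w = (s' ∷ xs') , (u' ∷ us')} {(s ∷ xs) , (u ∷ us)} adj with ◂-adjacent-inv {p' = s' , u'} {s , u} adj
... | inj₁ (adjʰ , refl) with adjacent-step adjʰ
...   | a , x , eq = block 0F a x , cong (_◂ (xs , us)) eq
neighbour-shift {suc m} {w = (s ∷ xs') , (u ∷ us')} {(s ∷ xs) , (u ∷ us)} adj | inj₂ (refl , adjᵗ) with neighbour-shift adjᵗ
...   | D , refl = liftDir D , sym (shift-liftDir D (s , u) (xs , us))

dropBlock : ∀ {k m J} → Columns k (Fin (suc m)) J → Columns k (Fin m) J
dropBlock C = record
  { blockCol = λ i → blockCol (suc i)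
  ; coordCol = coordCol
  ; blockCol-additive = λ i → blockCol-additive (suc i)
  ; coordCol-additive = coordCol-additive
  }
  where open Columns C

syndrome : ∀ {k m r} → Columns k (Fin m) (Fin r) → DoobV m (m + r) → Syn k
syndrome {m = zero} C ([] , us) = coordSyndrome (Columns.coordCol C) us
syndrome {m = suc m} C ((s ∷ xs) , (u ∷ us)) =
  Columns.blockCol C 0F (label (s , u)) ⊕ᵛ syndrome (dropBlock C) (xs , us)

shift-syndrome : ∀ {k m r} (C : Columns k (Fin m) (Fin r)) D v →
  syndrome C (shift D v) ≡ Columns.column C D ⊕ᵛ syndrome C v
shift-syndrome {m = zero} C (coord j d) ([] , us) = coordShift-syndrome coordCol coordCol-additive j d us
  where open Columns C
shift-syndrome {m = suc m} C (block 0F a x) ((s ∷ xs) , (u ∷ us)) = begin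
  blockCol 0F (label (step (s , u) a x)) ⊕ᵛ rest        ≡⟨ cong (λ l → blockCol 0F l ⊕ᵛ rest) (step-label (s , u) a x) ⟩
  blockCol 0F (label (s , u) ⊕² nz² a x) ⊕ᵛ rest        ≡⟨ cong (_⊕ᵛ rest) (blockCol-additive 0F _ _) ⟩
  blockCol 0F (label (s , u)) ⊕ᵛ blockCol 0F (nz² a x) ⊕ᵛ rest ≡⟨ ⊕ᵛ-rotate _ _ _ ⟩
  blockCol 0F (nz² a x) ⊕ᵛ (blockCol 0F (label (s , u)) ⊕ᵛ rest) ∎
  where
  open Columns C
  open ≡-Reasoning
  rest = syndrome (dropBlock C) (xs , us)
shift-syndrome {m = suc m} C (block (suc i) a x) ((s ∷ xs) , (u ∷ us)) =
  trans (cong (_ ⊕ᵛ_) (shift-syndrome (dropBlock C) (block i a x) (xs , us))) (⊕ᵛ-swap _ _ _)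
shift-syndrome {m = suc m} C (coord j d) ((s ∷ xs) , (u ∷ us)) =
  trans (cong (_ ⊕ᵛ_) (shift-syndrome (dropBlock C) (coord j d) (xs , us))) (⊕ᵛ-swap _ _ _)

-- A vertex of syndrome t ≠ 0 is covered by its neighbour in the
-- unique direction with column t, and by no other codeword.

perfectCode : ∀ {k m r} → PerfectCheck k (Fin m) (Fin r) → ∃[ C ] IsPerfectCode1 {m} {m + r} C
perfectCode {k} {m} {r} P = Code , λ v → covered v , unique v
  where
  open PerfectCheck P

  σ : DoobV m (m + r) → Syn k
  σ = syndrome columns

  Code : DoobV m (m + r) → Set
  Code v = σ v ≡ 0ᵛ

  codeword-in-ball : ∀ {c v} → Code c → InBall1 c v →
    (c ≡ v × σ v ≡ 0ᵛ) ⊎ (∃[ D ] c ≡ shift D v × column D ≡ σ v)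
  codeword-in-ball σc (inj₁ refl) = inj₁ (refl , σc)
  codeword-in-ball {v = v} σc (inj₂ adj) with neighbour-shift adj
  ... | D , refl = inj₂ (D , refl , ⊕ᵛ≡0⇒≡ _ _ (trans (sym (shift-syndrome columns D v)) σc))

  covered : ∀ v → ∃[ c ] (Code c × InBall1 c v)
  covered v with σ v ≟ᵛ 0ᵛ
  ... | yes σv≡0 = v , σv≡0 , inj₁ refl
  ... | no σv≢0 with column-cover (σ v) σv≢0
  ... | D , colD = shift D v , σ-shift , inj₂ (shift-adjacent D v)
    where
    σ-shift : σ (shift D v) ≡ 0ᵛ
    σ-shift = trans (shift-syndrome columns D v) (trans (cong (_⊕ᵛ σ v) colD) (⊕ᵛ-self (σ v)))

  unique : ∀ v c c' → Code c → Code c' → InBall1 c v → InBall1 c' v → c ≡ c'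
  unique v c c' σc σc' b b' with codeword-in-ball σc b | codeword-in-ball σc' b'
  ... | inj₁ (refl , _) | inj₁ (refl , _) = refl
  ... | inj₁ (_ , σv≡0) | inj₂ (D , _ , colD) = ⊥-elim (column-nonzero D (trans colD σv≡0))
  ... | inj₂ (D , _ , colD) | inj₁ (_ , σv≡0) = ⊥-elim (column-nonzero D (trans colD σv≡0))
  ... | inj₂ (D , refl , colD) | inj₂ (D' , refl , colD') =
    cong (λ D → shift D v) (column-injective D D' (trans colD (sym colD')))

mapDir : ∀ {I J I' J'} → (I → I') → (J → J') → Dir I J → Dir I' J'
mapDir f g (block i a x) = block (f i) a x
mapDir f g (coord j a) = coord (g j) a

mapDir-inverse : ∀ {I J I' J'} {f : I → I'} {f' : I' → I} {g : J → J'} {g' : J' → J} →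
  (∀ i → f' (f i) ≡ i) → (∀ j → g' (g j) ≡ j) → ∀ D → mapDir f' g' (mapDir f g D) ≡ D
mapDir-inverse f'f g'g (block i a x) = cong (λ i → block i a x) (f'f i)
mapDir-inverse f'f g'g (coord j a) = cong (λ j → coord j a) (g'g j)

reindex : ∀ {k I J I' J'} → PerfectCheck k I J → I' ↔ I → J' ↔ J → PerfectCheck k I' J'
reindex {k} {I} {J} {I'} {J'} P ι κ = record
  { columns = columns'
  ; column-nonzero = λ D eq → column-nonzero (forward D) (trans (sym (column-forward D)) eq)
  ; column-cover = cover'
  ; column-injective = injective'
  }
  where
  open PerfectCheck P
  open Inverse

  columns' : Columns k I' J'
  columns' = record
    { blockCol = λ i → blockCol (to ι i)
    ; coordCol = λ j → coordCol (to κ j)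
    ; blockCol-additive = λ i → blockCol-additive (to ι i)
    ; coordCol-additive = λ j → coordCol-additive (to κ j)
    }

  forward : Dir I' J' → Dir I J
  forward = mapDir (to ι) (to κ)

  backward : Dir I J → Dir I' J'
  backward = mapDir (from ι) (from κ)

  column-forward : ∀ D → Columns.column columns' D ≡ column (forward D)
  column-forward (block i a x) = refl
  column-forward (coord j a) = refl

  cover' : ∀ t → t ≢ 0ᵛ → ∃[ D ] Columns.column columns' D ≡ t
  cover' t t≢0 with column-cover t t≢0
  ... | D , colD = backward D ,
    trans (column-forward (backward D)) (trans (cong column (mapDir-inverse (strictlyInverseˡ ι) (strictlyInverseˡ κ) D)) colD)

  injective' : ∀ D D' → Columns.column columns' D ≡ Columns.column columns' D' → D ≡ D'
  injective' D D' eq = begin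
    D                        ≡⟨ sym (mapDir-inverse (strictlyInverseʳ ι) (strictlyInverseʳ κ) D) ⟩
    backward (forward D)     ≡⟨ cong backward (column-injective _ _ (trans (sym (column-forward D)) (trans eq (column-forward D')))) ⟩
    backward (forward D')    ≡⟨ mapDir-inverse (strictlyInverseʳ ι) (strictlyInverseʳ κ) D' ⟩
    D'                       ∎
    where open ≡-Reasoning

trivialCheck : PerfectCheck 0 (Fin 0) (Fin 0)
trivialCheck = record
  { columns = record { blockCol = λ () ; coordCol = λ () ; blockCol-additive = λ () ; coordCol-additive = λ () }
  ; column-nonzero = λ { (block () _ _) ; (coord () _) }
  ; column-cover = λ { [] []≢[] → ⊥-elim ([]≢[] refl) }
  ; column-injective = λ { (block () _ _) _ ; (coord () _) _ }
  }

-- Given a perfect check system over GF(4)^k whose lone coordinates are split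
-- as J₁ ⊎ J₂, add a new top row:
--   · each block i is replaced by four blocks (c, i) with top entry c·a;
--   · each lone coordinate j of J₁ is kept (top entry 0) and additionally
--     yields a new block with column (a, x) ↦ (a, eⱼ(x));
--   · each lone coordinate of J₂ is replaced by four copies with top entry c·a;
--   · one new lone coordinate has column (a, 0, …, 0).
-- A nonzero syndrome (f, s) is the column of exactly one new direction: the
-- new coordinate if s = 0, otherwise the unique lift of the old direction
-- with column s whose top entry is f.

module Extension {k : ℕ} {I J₁ J₂ : Set} (P : PerfectCheck k I (J₁ ⊎ J₂)) where
  open PerfectCheck P

  I' J' : Set
  I' = (F4 × I) ⊎ J₁
  J' = J₁ ⊎ ((F4 × J₂) ⊎ ⊤)

  blockCol' : I' → F4² → Syn (suc k)
  blockCol' (inj₁ (c , i)) (a , x) = c · a ∷ blockCol i (a , x)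
  blockCol' (inj₂ j) (a , x) = a ∷ coordCol (inj₁ j) x

  coordCol' : J' → F4 → Syn (suc k)
  coordCol' (inj₁ j) a = 0F ∷ coordCol (inj₁ j) a
  coordCol' (inj₂ (inj₁ (c , j))) a = c · a ∷ coordCol (inj₂ j) a
  coordCol' (inj₂ (inj₂ tt)) a = a ∷ 0ᵛ

  columns' : Columns (suc k) I' J'
  columns' = record
    { blockCol = blockCol'
    ; coordCol = coordCol'
    ; blockCol-additive = blockAdditive
    ; coordCol-additive = coordAdditive
    }
    where
    blockAdditive : ∀ i p q → blockCol' i (p ⊕² q) ≡ blockCol' i p ⊕ᵛ blockCol' i q
    blockAdditive (inj₁ (c , i)) (a , x) (b , y) = cong₂ _∷_ (·-distribˡ c a b) (blockCol-additive i (a , x) (b , y))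
    blockAdditive (inj₂ j) (a , x) (b , y) = cong (a ⊕ b ∷_) (coordCol-additive (inj₁ j) x y)
    coordAdditive : ∀ j a b → coordCol' j (a ⊕ b) ≡ coordCol' j a ⊕ᵛ coordCol' j b
    coordAdditive (inj₁ j) a b = cong (0F ∷_) (coordCol-additive (inj₁ j) a b)
    coordAdditive (inj₂ (inj₁ (c , j))) a b = cong₂ _∷_ (·-distribˡ c a b) (coordCol-additive (inj₂ j) a b)
    coordAdditive (inj₂ (inj₂ tt)) a b = cong (a ⊕ b ∷_) (sym (⊕ᵛ-identityˡ 0ᵛ))

  column' : Dir I' J' → Syn (suc k)
  column' = Columns.column columns'

  -- the old direction whose column is the lower part of the new column
  -- (nothing for the new lone coordinate)
  project : Dir I' J' → Maybe (Dir I (J₁ ⊎ J₂))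
  project (block (inj₁ (c , i)) a x) = just (block i a x)
  project (block (inj₂ j) a x) = just (coord (inj₁ j) x)
  project (coord (inj₁ j) a) = just (coord (inj₁ j) a)
  project (coord (inj₂ (inj₁ (c , j))) a) = just (coord (inj₂ j) a)
  project (coord (inj₂ (inj₂ tt)) a) = nothing

  -- the lift of an old direction with a prescribed top entry
  raise : Dir I (J₁ ⊎ J₂) → F4 → Dir I' J'
  raise (block i a x) f = block (inj₁ (f ÷ a , i)) a x
  raise (coord (inj₁ j) a) 0F = coord (inj₁ j) a
  raise (coord (inj₁ j) a) (suc f) = block (inj₂ j) f a
  raise (coord (inj₂ j) a) f = coord (inj₂ (inj₁ (f ÷ a , j))) a

  -- the same for the projection nothing, whose lifts are the new coordinate
  raise? : Maybe (Dir I (J₁ ⊎ J₂)) → F4 → Maybe (Dir I' J')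
  raise? (just D) f = just (raise D f)
  raise? nothing 0F = nothing
  raise? nothing (suc a) = just (coord (inj₂ (inj₂ tt)) a)

  columnOf? : Maybe (Dir I (J₁ ⊎ J₂)) → Syn k
  columnOf? = maybe column 0ᵛ

  column-raise : ∀ D f → column' (raise D f) ≡ f ∷ column D
  column-raise (block i a x) f = cong (_∷ _) (÷-· f a)
  column-raise (coord (inj₁ j) a) 0F = refl
  column-raise (coord (inj₁ j) a) (suc f) = refl
  column-raise (coord (inj₂ j) a) f = cong (_∷ _) (÷-· f a)

  tail-column : ∀ D → tail (column' D) ≡ columnOf? (project D)
  tail-column (block (inj₁ (c , i)) a x) = refl
  tail-column (block (inj₂ j) a x) = refl
  tail-column (coord (inj₁ j) a) = refl
  tail-column (coord (inj₂ (inj₁ (c , j))) a) = refl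
  tail-column (coord (inj₂ (inj₂ tt)) a) = refl

  raise?-project : ∀ D → raise? (project D) (head (column' D)) ≡ just D
  raise?-project (block (inj₁ (c , i)) a x) = cong (λ c → just (block (inj₁ (c , i)) a x)) (·-÷ c a)
  raise?-project (block (inj₂ j) a x) = refl
  raise?-project (coord (inj₁ j) a) = refl
  raise?-project (coord (inj₂ (inj₁ (c , j))) a) = cong (λ c → just (coord (inj₂ (inj₁ (c , j))) a)) (·-÷ c a)
  raise?-project (coord (inj₂ (inj₂ tt)) a) = refl

  columnOf?-injective : ∀ M M' → columnOf? M ≡ columnOf? M' → M ≡ M'
  columnOf?-injective (just D) (just D') eq = cong just (column-injective D D' eq)
  columnOf?-injective (just D) nothing eq = ⊥-elim (column-nonzero D eq)
  columnOf?-injective nothing (just D') eq = ⊥-elim (column-nonzero D' (sym eq))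
  columnOf?-injective nothing nothing eq = refl

  nonzero' : ∀ D → column' D ≢ 0ᵛ
  nonzero' (block (inj₁ (c , i)) a x) eq = column-nonzero (block i a x) (cong tail eq)
  nonzero' (block (inj₂ j) a x) eq = 0≢1+n (sym (cong head eq))
  nonzero' (coord (inj₁ j) a) eq = column-nonzero (coord (inj₁ j) a) (cong tail eq)
  nonzero' (coord (inj₂ (inj₁ (c , j))) a) eq = column-nonzero (coord (inj₂ j) a) (cong tail eq)
  nonzero' (coord (inj₂ (inj₂ tt)) a) eq = 0≢1+n (sym (cong head eq))

  -- (f, 0) is the new coordinate; (f, s) with s ≠ 0 lifts the direction with column s
  cover' : ∀ t → t ≢ 0ᵛ → ∃[ D ] column' D ≡ t
  cover' (f ∷ s) t≢0 with s ≟ᵛ 0ᵛ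
  cover' (0F ∷ s) t≢0 | yes refl = ⊥-elim (t≢0 refl)
  cover' (suc a ∷ s) t≢0 | yes refl = coord (inj₂ (inj₂ tt)) a , refl
  cover' (f ∷ s) t≢0 | no s≢0 with column-cover s s≢0
  ... | D , refl = raise D f , column-raise D f

  -- equal columns give equal projections and equal top entries
  injective' : ∀ D D' → column' D ≡ column' D' → D ≡ D'
  injective' D D' eq = just-injective (begin
    just D                                     ≡⟨ sym (raise?-project D) ⟩
    raise? (project D) (head (column' D))      ≡⟨ cong₂ raise? same-projection (cong head eq) ⟩
    raise? (project D') (head (column' D'))    ≡⟨ raise?-project D' ⟩
    just D'                                    ∎)
    where
    open ≡-Reasoning
    same-projection : project D ≡ project D'
    same-projection = columnOf?-injective _ _ (trans (sym (tail-column D)) (trans (cong tail eq) (tail-column D')))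

  extended : PerfectCheck (suc k) I' J'
  extended = record
    { columns = columns'
    ; column-nonzero = nonzero'
    ; column-cover = cover'
    ; column-injective = injective'
    }

extendFin : ∀ {k m₀ j r₂} → PerfectCheck k (Fin m₀) (Fin (j + r₂)) →
  PerfectCheck (suc k) (Fin (4 * m₀ + j)) (Fin (j + (4 * r₂ + 1)))
extendFin P = reindex (Extension.extended (reindex P ↔-refl (↔-sym +↔⊎)))
  (↔-trans +↔⊎ (*↔× ⊎-↔ ↔-refl))
  (↔-trans +↔⊎ (↔-refl ⊎-↔ ↔-trans +↔⊎ (*↔× ⊎-↔ 1↔⊤)))

-- A perfect check system over GF(4)^μ with m blocks and r lone
-- coordinates has 9m + 3r = 4^μ − 1 directions, i.e. 3m + r = triples μ.
-- Extension turns (m₀, j + r₂) into (4m₀ + j, j + 4r₂ + 1); starting from the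
-- largest m₀ = maxBlocks μ (for which r = μ) and j = μ gives maxBlocks (μ+1),
-- and every smaller m is reached as well.

maxBlocks : ℕ → ℕ
maxBlocks zero = 0
maxBlocks (suc μ) = 4 * maxBlocks μ + μ

-- (4^μ − 1)/3, by triples-count
triples : ℕ → ℕ
triples μ = 3 * maxBlocks μ + μ

triples-suc : ∀ μ → triples (suc μ) ≡ 4 * triples μ + 1
triples-suc μ = lemma (maxBlocks μ) μ
  where
  lemma : ∀ B μ → 3 * (4 * B + μ) + suc μ ≡ 4 * (3 * B + μ) + 1
  lemma = solve-∀

triples-count : ∀ μ → 3 * triples μ + 1 ≡ 4 ^ μ
triples-count zero = refl
triples-count (suc μ) = begin
  3 * triples (suc μ) + 1      ≡⟨ cong (λ t → 3 * t + 1) (triples-suc μ) ⟩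
  3 * (4 * triples μ + 1) + 1  ≡⟨ lemma (triples μ) ⟩
  4 * (3 * triples μ + 1)      ≡⟨ cong (4 *_) (triples-count μ) ⟩
  4 * 4 ^ μ                    ∎
  where
  open ≡-Reasoning
  lemma : ∀ t → 3 * (4 * t + 1) + 1 ≡ 4 * (3 * t + 1)
  lemma = solve-∀

-- any m ≤ 4B + X splits as 4m₀ + j with m₀ ≤ B and 3m₀ + j ≤ 3B + X
-- (remove fours while fewer than B have been removed; the rest is j)
blockSplit : ∀ B X m → m ≤ 4 * B + X →
  ∃[ m₀ ] ∃[ j ] m ≡ 4 * m₀ + j × m₀ ≤ B × 3 * m₀ + j ≤ 3 * B + X
blockSplit zero X m m≤X = 0 , m , refl , z≤n , m≤X
blockSplit (suc B) X m m≤ with m <? 4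
... | yes m<4 = 0 , m , refl , z≤n , ≤-trans (≤-pred m<4) (≤-trans (*-monoʳ-≤ 3 (s≤s z≤n)) (m≤m+n _ X))
... | no m≮4 = dropFour (m≤n⇒∃[o]m+o≡n (≮⇒≥ m≮4))
  where
  lemma₁ : ∀ B X → 4 * suc B + X ≡ 4 + (4 * B + X)
  lemma₁ = solve-∀
  lemma₂ : ∀ m₀ j → 4 + (4 * m₀ + j) ≡ 4 * suc m₀ + j
  lemma₂ = solve-∀
  lemma₃ : ∀ m₀ j → 3 + (3 * m₀ + j) ≡ 3 * suc m₀ + j
  lemma₃ = solve-∀
  dropFour : ∃[ o ] 4 + o ≡ m → ∃[ m₀ ] ∃[ j ] m ≡ 4 * m₀ + j × m₀ ≤ suc B × 3 * m₀ + j ≤ 3 * suc B + X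
  dropFour (o , refl) with blockSplit B X o (+-cancelˡ-≤ 4 o (4 * B + X) (subst (4 + o ≤_) (lemma₁ B X) m≤))
  ... | m₀ , j , refl , m₀≤B , bound =
    suc m₀ , j , lemma₂ m₀ j , s≤s m₀≤B , subst₂ _≤_ (lemma₃ m₀ j) (lemma₃ B X) (+-monoʳ-≤ 3 bound)

splitLevel : ∀ μ {m r} → m ≤ maxBlocks (suc μ) → 3 * m + r ≡ triples (suc μ) →
  ∃[ m₀ ] ∃[ j ] ∃[ r₂ ] m ≡ 4 * m₀ + j × r ≡ j + (4 * r₂ + 1) ×
                         m₀ ≤ maxBlocks μ × 3 * m₀ + (j + r₂) ≡ triples μ
splitLevel μ {m} {r} m≤ count with blockSplit (maxBlocks μ) μ m m≤
... | m₀ , j , refl , m₀≤ , bound = m₀ , j , r₂ , refl , r≡ , m₀≤ , trans (sym (+-assoc (3 * m₀) j r₂)) filled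
  where
  r₂ = triples μ ∸ (3 * m₀ + j)
  filled : 3 * m₀ + j + r₂ ≡ triples μ
  filled = m+[n∸m]≡n bound
  lemma : ∀ m₀ j r₂ → 4 * (3 * m₀ + j + r₂) + 1 ≡ 3 * (4 * m₀ + j) + (j + (4 * r₂ + 1))
  lemma = solve-∀
  r≡ : r ≡ j + (4 * r₂ + 1)
  r≡ = +-cancelˡ-≡ (3 * (4 * m₀ + j)) r _ (begin
    3 * (4 * m₀ + j) + r                  ≡⟨ count ⟩
    triples (suc μ)                       ≡⟨ triples-suc μ ⟩
    4 * triples μ + 1                     ≡⟨ cong (λ t → 4 * t + 1) (sym filled) ⟩
    4 * (3 * m₀ + j + r₂) + 1             ≡⟨ lemma m₀ j r₂ ⟩
    3 * (4 * m₀ + j) + (j + (4 * r₂ + 1)) ∎)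
    where open ≡-Reasoning

reachable : ∀ μ {m r} → m ≤ maxBlocks μ → 3 * m + r ≡ triples μ → PerfectCheck μ (Fin m) (Fin r)
reachable zero {zero} {zero} _ _ = trivialCheck
reachable zero {zero} {suc r} _ ()
reachable (suc μ) m≤ count with splitLevel μ m≤ count
... | m₀ , j , r₂ , refl , refl , m₀≤ , count₀ = extendFin (reachable μ m₀≤ count₀)

-- The bound on m in the theorem implies m ≤ maxBlocks μ: by triples-count,
-- 4^μ = 9 maxBlocks μ + 3μ + 1, so the hypothesis reads
-- 18m + 5·2^μ ≤ 18 maxBlocks μ + 6μ + 4 for odd μ and
-- 9m + 2·2^μ ≤ 9 maxBlocks μ + 3μ + 2 for even μ ≥ 2; the exponential beats
-- the linear term in both cases.

pow-bound-odd : ∀ μ → 6 * μ + 4 ≤ 5 * 2 ^ μ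
pow-bound-odd zero = s≤s (s≤s (s≤s (s≤s z≤n)))
pow-bound-odd (suc zero) = ≤-refl
pow-bound-odd (suc (suc μ)) = begin
  6 * suc (suc μ) + 4                       ≤⟨ m≤m+n _ (6 * μ + 4) ⟩
  6 * suc (suc μ) + 4 + (6 * μ + 4)         ≡⟨ lemma₁ μ ⟩
  2 * (6 * suc μ + 4)                       ≤⟨ *-monoʳ-≤ 2 (pow-bound-odd (suc μ)) ⟩
  2 * (5 * 2 ^ suc μ)                       ≡⟨ lemma₂ (2 ^ μ) ⟩
  5 * 2 ^ suc (suc μ)                       ∎
  where
  open ≤-Reasoning
  lemma₁ : ∀ μ → 6 * suc (suc μ) + 4 + (6 * μ + 4) ≡ 2 * (6 * suc μ + 4)
  lemma₁ = solve-∀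
  lemma₂ : ∀ x → 2 * (5 * (2 * x)) ≡ 5 * (2 * (2 * x))
  lemma₂ = solve-∀

pow-bound-even : ∀ μ → 3 * (2 + μ) + 2 ≤ 2 * 2 ^ (2 + μ)
pow-bound-even zero = ≤-refl
pow-bound-even (suc μ) = begin
  3 * (3 + μ) + 2                           ≤⟨ m≤m+n _ (3 * μ + 5) ⟩
  3 * (3 + μ) + 2 + (3 * μ + 5)             ≡⟨ lemma μ ⟩
  2 * (3 * (2 + μ) + 2)                     ≤⟨ *-monoʳ-≤ 2 (pow-bound-even μ) ⟩
  2 * (2 * 2 ^ (2 + μ))                     ∎
  where
  open ≤-Reasoning
  lemma : ∀ μ → 3 * (3 + μ) + 2 + (3 * μ + 5) ≡ 2 * (3 * (2 + μ) + 2)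
  lemma = solve-∀

parity : ∀ μ → (∃[ k ] μ ≡ 2 * k + 1) ⊎ (∃[ k ] μ ≡ 2 * k)
parity zero = inj₂ (0 , refl)
parity (suc μ) with parity μ
... | inj₁ (k , refl) = inj₂ (suc k , lemma k)
  where
  lemma : ∀ k → suc (2 * k + 1) ≡ 2 * suc k
  lemma = solve-∀
... | inj₂ (k , refl) = inj₁ (k , +-comm 1 (2 * k))

cancel-bound : ∀ c {m B e f} .{{_ : NonZero c}} → c * m + f ≤ c * B + e → e ≤ f → m ≤ B
cancel-bound c {m} {B} {e} {f} le e≤f =
  *-cancelˡ-≤ c (+-cancelʳ-≤ f (c * m) (c * B) (≤-trans le (+-monoʳ-≤ (c * B) e≤f)))

maxBlocks-bound : ∀ μ m → NonZero μ →
  (∀ k → μ ≡ 2 * k + 1 → 18 * m + 5 * 2 ^ μ ≤ 2 * 4 ^ μ + 2) →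
  (∀ k → μ ≡ 2 * k → 9 * m + 2 * 2 ^ μ ≤ 4 ^ μ + 1) →
  m ≤ maxBlocks μ
maxBlocks-bound μ m nzμ odd even with parity μ
... | inj₁ (k , μ≡) = cancel-bound 18 (subst (18 * m + 5 * 2 ^ μ ≤_) rhs (odd k μ≡)) (pow-bound-odd μ)
  where
  lemma : ∀ B μ → 2 * (3 * (3 * B + μ) + 1) + 2 ≡ 18 * B + (6 * μ + 4)
  lemma = solve-∀
  rhs : 2 * 4 ^ μ + 2 ≡ 18 * maxBlocks μ + (6 * μ + 4)
  rhs = trans (cong (λ z → 2 * z + 2) (sym (triples-count μ))) (lemma (maxBlocks μ) μ)
... | inj₂ (zero , refl) = ⊥-elim (NonZero.nonZero nzμ)
... | inj₂ (suc k , μ≡) = cancel-bound 9 (subst (9 * m + 2 * 2 ^ μ ≤_) rhs (even (suc k) μ≡))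
                           (subst (λ z → 3 * z + 2 ≤ 2 * 2 ^ z) (sym μ≡2+2k) (pow-bound-even (k + k)))
  where
  lemma : ∀ B μ → 3 * (3 * B + μ) + 1 + 1 ≡ 9 * B + (3 * μ + 2)
  lemma = solve-∀
  rhs : 4 ^ μ + 1 ≡ 9 * maxBlocks μ + (3 * μ + 2)
  rhs = trans (cong (_+ 1) (sym (triples-count μ))) (lemma (maxBlocks μ) μ)
  double : ∀ k → 2 * suc k ≡ 2 + (k + k)
  double = solve-∀
  μ≡2+2k : μ ≡ 2 + (k + k)
  μ≡2+2k = trans μ≡ (double k)

-- With 2m + n = triples μ and m ≤ maxBlocks μ there is a K coordinate for
-- every Shrikhande coordinate, so D(m, n) = D(m, m + r) for r = n ∸ m, and
-- (m, r) is admissible.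

enough-K-coordinates : ∀ μ {m n} → 2 * m + n ≡ triples μ → m ≤ maxBlocks μ → m ≤ n
enough-K-coordinates μ {m} {n} size m≤ = +-cancelˡ-≤ (2 * m) m n (begin
  2 * m + m              ≡⟨ lemma m ⟩
  3 * m                  ≤⟨ *-monoʳ-≤ 3 m≤ ⟩
  3 * maxBlocks μ        ≤⟨ m≤m+n _ μ ⟩
  triples μ              ≡⟨ sym size ⟩
  2 * m + n              ∎)
  where
  open ≤-Reasoning
  lemma : ∀ m → 2 * m + m ≡ 3 * m
  lemma = solve-∀

admissible : ∀ μ {m n} → 2 * m + n ≡ triples μ → m ≤ n → 3 * m + (n ∸ m) ≡ triples μ
admissible μ {m} {n} size m≤n = begin
  3 * m + (n ∸ m)        ≡⟨ lemma m (n ∸ m) ⟩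
  2 * m + (m + (n ∸ m))  ≡⟨ cong (2 * m +_) (m+[n∸m]≡n m≤n) ⟩
  2 * m + n              ≡⟨ size ⟩
  triples μ              ∎
  where
  open ≡-Reasoning
  lemma : ∀ m r → 3 * m + r ≡ 2 * m + (m + r)
  lemma = solve-∀

theorem4 : ∀ (m n μ : ℕ) → NonZero m → NonZero n → NonZero μ →
  3 * (2 * m + n) + 1 ≡ 4 ^ μ →
  (∀ k → μ ≡ 2 * k + 1 → 18 * m + 5 * 2 ^ μ ≤ 2 * 4 ^ μ + 2) →
  (∀ k → μ ≡ 2 * k → 9 * m + 2 * 2 ^ μ ≤ 4 ^ μ + 1) →
  ∃[ C ] IsPerfectCode1 {m} {n} C
theorem4 m n μ _ _ nzμ count odd even =
  subst (λ n → ∃[ C ] IsPerfectCode1 {m} {n} C) (m+[n∸m]≡n m≤n)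
    (perfectCode (reachable μ m≤max (admissible μ size m≤n)))
  where
  size : 2 * m + n ≡ triples μ
  size = *-cancelˡ-≡ _ _ 3 (+-cancelʳ-≡ 1 _ _ (trans count (sym (triples-count μ))))
  m≤max : m ≤ maxBlocks μ
  m≤max = maxBlocks-bound μ m nzμ odd even
  m≤n : m ≤ n
  m≤n = enough-K-coordinates μ size m≤max
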